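{- Let $m\in\mathbb{N}$, $N=2^{m+1}$, and let $I$ be the set of $2m$ rectangles $V_1,\dots,V_m,H_1,\dots,H_m$ defined below. For any constant $0<\varepsilon<\frac12$, a $k$-stage packing of $I'\subseteq I$ in the $N\times N$ knapsack with $|I|\le(2-\varepsilon)|I'|$ is possible only if $k=\Omega(\varepsilon\log N)$.
   Context: For $j\in[m]$, $V_j$ is a vertical rectangle of height $N-(2^j-1)$ and width $2^{j-1}$, and $H_j$ is a horizontal rectangle of height $2^{j-1}$ and width $N-(2^{j-1}-1)$ (all of $I$ can be packed in a guillotine separable way). Packings place rectangles by translation as pairwise disjoint open rectangles in $[0,N]^2$. A $k$-stage packing is one that can be separated by a guillotine cutting process organized in $k$ stages: in each stage every current piece is cut by end-to-end axis-parallel cuts (not crossing any item) all of the same orientation, the orientation alternating between consecutive stages, so that after $k$ stages each piece contains at most one item (plus a final trimming cut separating the item from waste).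
   Formalization: The positions of the rectangles in a packing and the coordinates of its guillotine cuts are rational, and the constant ε ranges over the rationals. -}

module Defs where

open import Data.Nat as ℕ using (ℕ; zero; suc; _∸_; _^_)
open import Data.Integer using (+_)
open import Data.Rational using (ℚ; _/_; _+_; _≤_; _<_)
open import Data.Fin using (Fin; toℕ; splitAt)
open import Data.Fin.Subset using (Subset; _∈_)
open import Data.Sum using (_⊎_; inj₁; inj₂)
open import Data.Product using (_×_; _,_; Σ; ∃; proj₁; proj₂)
open import Relation.Binary.PropositionalEquality using (_≡_)
import Data.Empty

ℕ→ℚ : ℕ → ℚ
ℕ→ℚ n = + n / 1

Nsize : ℕ → ℕ
Nsize m = 2 ^ suc m

-- The instance I consists of 2m items, indexed by Fin (m + m):
-- splitAt m i = inj₁ j  is  V_(j+1),   splitAt m i = inj₂ j  is  H_(j+1).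
-- For j ∈ [m] (here j = toℕ j' + 1):
--   V_j : width 2^(j-1), height N - (2^j - 1)
--   H_j : width N - (2^(j-1) - 1), height 2^(j-1)
width : (m : ℕ) → Fin (m ℕ.+ m) → ℕ
width m i with splitAt m i
... | inj₁ j = 2 ^ toℕ j
... | inj₂ j = Nsize m ∸ (2 ^ toℕ j ∸ 1)

height : (m : ℕ) → Fin (m ℕ.+ m) → ℕ
height m i with splitAt m i
... | inj₁ j = Nsize m ∸ (2 ^ suc (toℕ j) ∸ 1)
... | inj₂ j = 2 ^ toℕ j

record Box : Set where
  constructor box
  field
    bx₀ bx₁ by₀ by₁ : ℚ

open Box

-- orientation of the cuts of a stage:
-- vert = cuts are vertical lines x = c, horiz = horizontal lines y = c
data Orient : Set where
  vert horiz : Orient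

flip : Orient → Orient
flip vert  = horiz
flip horiz = vert

lo hi : Orient → Box → ℚ
lo vert B = bx₀ B
lo horiz B = by₀ B
hi vert B = bx₁ B
hi horiz B = by₁ B

lower upper : Orient → ℚ → Box → Box
lower vert c B = box (bx₀ B) c (by₀ B) (by₁ B)
lower horiz c B = box (bx₀ B) (bx₁ B) (by₀ B) c
upper vert c B = box c (bx₁ B) (by₀ B) (by₁ B)
upper horiz c B = box (bx₀ B) (bx₁ B) c (by₁ B)

-- A placement assigns to each item the lower-left corner (x , y) of its
-- (translated) copy; the item then occupies the open rectangle
-- (x, x + w) × (y, y + h).
Placement : ℕ → Set
Placement m = Fin (m ℕ.+ m) → ℚ × ℚ

module _ (m : ℕ) (pos : Placement m) where

  x₀ y₀ x₁ y₁ : Fin (m ℕ.+ m) → ℚ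
  x₀ i = proj₁ (pos i)
  y₀ i = proj₂ (pos i)
  x₁ i = x₀ i + ℕ→ℚ (width m i)
  y₁ i = y₀ i + ℕ→ℚ (height m i)

  record IsPacking (S : Subset (m ℕ.+ m)) : Set where
    field
      inside   : ∀ i → i ∈ S →
                 (ℕ→ℚ 0 ≤ x₀ i) × (x₁ i ≤ ℕ→ℚ (Nsize m)) ×
                 (ℕ→ℚ 0 ≤ y₀ i) × (y₁ i ≤ ℕ→ℚ (Nsize m))
      disjoint : ∀ i j → i ∈ S → j ∈ S → (i ≡ j → Data.Empty.⊥) →
                 (x₁ i ≤ x₀ j) ⊎ (x₁ j ≤ x₀ i) ⊎ (y₁ i ≤ y₀ j) ⊎ (y₁ j ≤ y₀ i)

  module _ (S : Subset (m ℕ.+ m)) where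

    In : Fin (m ℕ.+ m) → Box → Set
    In i B = (i ∈ S) × (bx₀ B ≤ x₀ i) × (x₁ i ≤ bx₁ B) × (by₀ B ≤ y₀ i) × (y₁ i ≤ by₁ B)

    AtMostOne : Box → Set
    AtMostOne B = ∀ i j → In i B → In j B → i ≡ j

    NoCross : Orient → ℚ → Box → Set
    NoCross vert c B = ∀ i → In i B → (x₁ i ≤ c) ⊎ (c ≤ x₀ i)
    NoCross horiz c B = ∀ i → In i B → (y₁ i ≤ c) ⊎ (c ≤ y₀ i)

    -- Sep k o B : the piece B can be separated in k stages, the first of
    -- which uses cuts of orientation o (orientations alternate).
    -- Cuts k o B : B is cut by a family of parallel cuts of orientation o
    -- (one stage), and each resulting piece is separable in k further
    -- stages starting with orientation flip o.
    data Sep : ℕ → Orient → Box → Set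
    data Cuts : ℕ → Orient → Box → Set

    data Sep where
      done  : ∀ {k o B} → AtMostOne B → Sep k o B
      stage : ∀ {k o B} → Cuts k o B → Sep (suc k) o B

    data Cuts where
      last : ∀ {k o B} → Sep k (flip o) B → Cuts k o B
      cut  : ∀ {k o B} (c : ℚ) → lo o B < c → c < hi o B → NoCross o c B →
             Cuts k o (lower o c B) → Sep k (flip o) (upper o c B) → Cuts k o B

KStagePacking : (m : ℕ) → Subset (m ℕ.+ m) → ℕ → Set
KStagePacking m S k =
  Σ (Placement m) λ pos → IsPacking m pos S ×
    Σ Orient λ o →
      Sep m pos S k o (box (ℕ→ℚ 0) (ℕ→ℚ (Nsize m)) (ℕ→ℚ 0) (ℕ→ℚ (Nsize m)))

{-# OPTIONS --safe #-}
module Submission where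

-- Call j paired in S when both V_j and H_j belong to S.  For paired i < j the bar H_i is
-- too wide to stand beside V_j or H_j, and V_i too tall to stand above or below them, so
-- a stage of vertical (horizontal) cuts leaves every item of a later pair in the piece of
-- H_i (V_i).  Hence each stage separates at most the pair of smallest index, while a piece
-- still holding a whole pair needs another stage: k is at least the number of paired
-- indices, which is at least |S| − m.  With 2m ≤ (2 − ε)|S| this gives εm ≤ 2k.

open import Defs
open import Data.Nat as ℕ using (ℕ)
open import Data.Integer using (+_)
open import Data.Rational using (ℚ; _+_; _-_; _*_; _≤_; _<_; 0ℚ; ½)
open import Data.Fin.Subset using (Subset; ∣_∣)
open import Data.Product using (Σ; _×_)

open import Data.Nat using (suc; _∸_; _^_; z≤n; s≤s)
import Data.Nat.Properties as ℕP
import Data.Nat.Coprimality as Coprime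
import Data.Integer as ℤ
import Data.Integer.Properties as ℤP
open import Data.Rational using (-_; mkℚ; 1ℚ; *≤*; *<*; nonNegative)
import Data.Rational.Properties as ℚP
import Data.Rational.Unnormalised as ℚᵘ
import Data.Rational.Unnormalised.Properties as ℚᵘP
open import Data.Rational.Solver using (module +-*-Solver)
open import Data.Fin using (Fin; toℕ; splitAt; _↑ˡ_; _↑ʳ_) renaming (_<_ to _<ᶠ_)
import Data.Fin.Properties as FinP
open import Data.Fin.Subset using (_∈_; _∩_; _∪_; inside; outside)
open import Data.Fin.Subset.Properties using (∣p∣≤n; x∈p∩q⁻)
open import Data.Vec using ([]; _∷_; _++_; here; there)
import Data.Vec as Vec
open import Data.List using (List; []; _∷_; length; map)
import Data.List.Properties as ListP
open import Data.List.Relation.Unary.All using (All; []; _∷_)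
import Data.List.Relation.Unary.All as All
import Data.List.Relation.Unary.All.Properties as AllP
open import Data.List.Relation.Unary.AllPairs using (AllPairs; []; _∷_)
import Data.List.Relation.Unary.AllPairs as AllPairs
import Data.List.Relation.Unary.AllPairs.Properties as AllPairsP
open import Data.Product using (_,_; proj₁; proj₂)
open import Data.Sum using (_⊎_; inj₁; inj₂)
open import Data.Empty using (⊥-elim)
open import Relation.Nullary using (¬_)
open import Relation.Binary.PropositionalEquality

integral : ℕ → ℚ
integral n = mkℚ (+ n) 0 (Coprime.sym (Coprime.1-coprimeTo n))

ℕ→ℚ≡integral : ∀ n → ℕ→ℚ n ≡ integral n
ℕ→ℚ≡integral n = ℚP.normalize-coprime _

ℕ→ℚ-mono-≤ : ∀ {a b} → a ℕ.≤ b → ℕ→ℚ a ≤ ℕ→ℚ b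
ℕ→ℚ-mono-≤ {a} {b} a≤b rewrite ℕ→ℚ≡integral a | ℕ→ℚ≡integral b =
  *≤* (subst₂ ℤ._≤_ (sym (ℤP.*-identityʳ (+ a))) (sym (ℤP.*-identityʳ (+ b))) (ℤ.+≤+ a≤b))

ℕ→ℚ-cancel-≤ : ∀ {a b} → ℕ→ℚ a ≤ ℕ→ℚ b → a ℕ.≤ b
ℕ→ℚ-cancel-≤ {a} {b} a≤b rewrite ℕ→ℚ≡integral a | ℕ→ℚ≡integral b =
  ℤP.drop‿+≤+ (subst₂ ℤ._≤_ (ℤP.*-identityʳ (+ a)) (ℤP.*-identityʳ (+ b)) (ℚP.drop-*≤* a≤b))

ℕ→ℚ-+ : ∀ a b → ℕ→ℚ (a ℕ.+ b) ≡ ℕ→ℚ a + ℕ→ℚ b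
ℕ→ℚ-+ a b rewrite ℕ→ℚ≡integral a | ℕ→ℚ≡integral b | ℕ→ℚ≡integral (a ℕ.+ b) =
  ℚP.toℚᵘ-injective (ℚᵘP.≃-sym (ℚᵘP.≃-trans (ℚP.toℚᵘ-homo-+ (integral a) (integral b)) (ℚᵘ.*≡* cross)))
  where
  cross : (+ a ℤ.* + 1 ℤ.+ + b ℤ.* + 1) ℤ.* + 1 ≡ + (a ℕ.+ b) ℤ.* (+ 1 ℤ.* + 1)
  cross rewrite ℤP.*-identityʳ (+ a) | ℤP.*-identityʳ (+ b) | ℤP.*-identityʳ (+ a ℤ.+ + b) = refl

0≤p+q : ∀ {p q} → 0ℚ ≤ p → 0ℚ ≤ q → 0ℚ ≤ p + q
0≤p+q = ℚP.+-mono-≤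

0≤p*q : ∀ {p q} → 0ℚ ≤ p → 0ℚ ≤ q → 0ℚ ≤ p * q
0≤p*q {p} {q} 0≤p 0≤q =
  ℚP.nonNegative⁻¹ (p * q) {{ℚP.nonNeg*nonNeg⇒nonNeg p {{nonNegative 0≤p}} q {{nonNegative 0≤q}}}}

0≤q-p : ∀ {p q} → p ≤ q → 0ℚ ≤ q - p
0≤q-p {p} {q} p≤q = subst (_≤ q - p) (ℚP.+-inverseʳ p) (ℚP.+-monoˡ-≤ (- p) p≤q)

p≤p+q : ∀ {p q} → 0ℚ ≤ q → p ≤ p + q
p≤p+q {p} 0≤q = subst (_≤ p + _) (ℚP.+-identityʳ p) (ℚP.+-monoʳ-≤ p 0≤q)

¼E[1+M]≤K : ∀ E S M K → 0ℚ ≤ E → 0ℚ ≤ S → 1ℚ ≤ M → S ≤ M + K →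
            M + M ≤ (ℕ→ℚ 2 - E) * S → ½ * ½ * E * (1ℚ + M) ≤ K
¼E[1+M]≤K E S M K 0≤E 0≤S 1≤M S≤M+K 2M≤[2-E]S = begin
  ½ * ½ * E * (1ℚ + M)          ≤⟨ p≤p+q 0≤slack ⟩
  ½ * ½ * E * (1ℚ + M) + slack  ≡⟨ certificate ⟨
  K                             ∎
  where
  open ℚP.≤-Reasoning
  open +-*-Solver
  b = (ℕ→ℚ 2 - E) * S - (M + M)
  ¼E = ½ * ½ * E
  slack = (M + K - S) + (½ * b + (¼E * b + (¼E * (E * S) + ¼E * (M - 1ℚ))))
  0≤½ : 0ℚ ≤ ½
  0≤½ = *≤* (ℤ.+≤+ z≤n)
  0≤¼E = 0≤p*q (0≤p*q 0≤½ 0≤½) 0≤E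
  0≤b = 0≤q-p 2M≤[2-E]S
  0≤slack : 0ℚ ≤ slack
  0≤slack = 0≤p+q (0≤q-p S≤M+K) (0≤p+q (0≤p*q 0≤½ 0≤b)
              (0≤p+q (0≤p*q 0≤¼E 0≤b) (0≤p+q (0≤p*q 0≤¼E (0≤p*q 0≤E 0≤S)) (0≤p*q 0≤¼E (0≤q-p 1≤M)))))
  certificate : K ≡ ¼E * (1ℚ + M) + slack
  certificate = solve 4 (λ e s m k → k := con ½ :* con ½ :* e :* (con 1ℚ :+ m) :+
    ((m :+ k :- s) :+ (con ½ :* ((con (ℕ→ℚ 2) :- e) :* s :- (m :+ m)) :+
      (con ½ :* con ½ :* e :* ((con (ℕ→ℚ 2) :- e) :* s :- (m :+ m)) :+
        (con ½ :* con ½ :* e :* (e :* s) :+ con ½ :* con ½ :* e :* (m :- con 1ℚ)))))) refl E S M K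

2^a∸1<2^a : ∀ a → 2 ^ a ∸ 1 ℕ.< 2 ^ a
2^a∸1<2^a a = ℕP.≤-reflexive (ℕP.suc-pred (2 ^ a) {{ℕP.m^n≢0 2 a}})

2^a∸1<2^b : ∀ {a b} → a ℕ.≤ b → 2 ^ a ∸ 1 ℕ.< 2 ^ b
2^a∸1<2^b {a} a≤b = ℕP.<-≤-trans (2^a∸1<2^a a) (ℕP.^-monoʳ-≤ 2 a≤b)

2^a∸1<2^[1+m]∸[2^b∸1] : ∀ {a b m} → a ℕ.≤ b → b ℕ.≤ m → 2 ^ a ∸ 1 ℕ.< 2 ^ suc m ∸ (2 ^ b ∸ 1)
2^a∸1<2^[1+m]∸[2^b∸1] {a} {b} {m} a≤b b≤m = ℕP.m+n≤o⇒m≤o∸n (suc (2 ^ a ∸ 1)) (begin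
  suc (2 ^ a ∸ 1) ℕ.+ (2 ^ b ∸ 1) ≤⟨ ℕP.+-mono-≤ (2^a∸1<2^a a) (ℕP.m∸n≤m (2 ^ b) 1) ⟩
  2 ^ a ℕ.+ 2 ^ b                 ≤⟨ ℕP.+-monoˡ-≤ (2 ^ b) (ℕP.^-monoʳ-≤ 2 a≤b) ⟩
  2 ^ b ℕ.+ 2 ^ b                 ≡⟨ cong (2 ^ b ℕ.+_) (ℕP.+-identityʳ (2 ^ b)) ⟨
  2 ^ suc b                       ≤⟨ ℕP.^-monoʳ-≤ 2 (s≤s b≤m) ⟩
  2 ^ suc m                       ∎)
  where open ℕP.≤-Reasoning

n<n∸x+y : ∀ {n x y} → x ℕ.≤ n → x ℕ.< y → n ℕ.< n ∸ x ℕ.+ y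
n<n∸x+y {n} {x} {y} x≤n x<y = begin-strict
  n           ≡⟨ ℕP.m∸n+n≡m x≤n ⟨
  n ∸ x ℕ.+ x <⟨ ℕP.+-monoʳ-< (n ∸ x) x<y ⟩
  n ∸ x ℕ.+ y ∎
  where open ℕP.≤-Reasoning

elements : ∀ {n} → Subset n → List (Fin n)
elements []            = []
elements (inside ∷ p)  = Fin.zero ∷ map Fin.suc (elements p)
elements (outside ∷ p) = map Fin.suc (elements p)

elements-∈ : ∀ {n} (p : Subset n) → All (_∈ p) (elements p)
elements-∈ []            = []
elements-∈ (inside ∷ p)  = here ∷ AllP.map⁺ (All.map there (elements-∈ p))
elements-∈ (outside ∷ p) = AllP.map⁺ (All.map there (elements-∈ p))

elements-sorted : ∀ {n} (p : Subset n) → AllPairs _<ᶠ_ (elements p)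
elements-sorted []            = []
elements-sorted (inside ∷ p)  =
  AllP.map⁺ (All.universal (λ _ → s≤s z≤n) (elements p)) ∷ AllPairsP.map⁺ (AllPairs.map s≤s (elements-sorted p))
elements-sorted (outside ∷ p) = AllPairsP.map⁺ (AllPairs.map s≤s (elements-sorted p))

length-elements : ∀ {n} (p : Subset n) → length (elements p) ≡ ∣ p ∣
length-elements []            = refl
length-elements (inside ∷ p)  = cong suc (trans (ListP.length-map Fin.suc (elements p)) (length-elements p))
length-elements (outside ∷ p) = trans (ListP.length-map Fin.suc (elements p)) (length-elements p)

∣p∣+∣q∣≡∣p∪q∣+∣p∩q∣ : ∀ {n} (p q : Subset n) → ∣ p ∣ ℕ.+ ∣ q ∣ ≡ ∣ p ∪ q ∣ ℕ.+ ∣ p ∩ q ∣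
∣p∣+∣q∣≡∣p∪q∣+∣p∩q∣ []            []            = refl
∣p∣+∣q∣≡∣p∪q∣+∣p∩q∣ (inside ∷ p)  (inside ∷ q)  =
  cong suc (trans (ℕP.+-suc ∣ p ∣ ∣ q ∣) (trans (cong suc (∣p∣+∣q∣≡∣p∪q∣+∣p∩q∣ p q)) (sym (ℕP.+-suc ∣ p ∪ q ∣ ∣ p ∩ q ∣))))
∣p∣+∣q∣≡∣p∪q∣+∣p∩q∣ (inside ∷ p)  (outside ∷ q) = cong suc (∣p∣+∣q∣≡∣p∪q∣+∣p∩q∣ p q)
∣p∣+∣q∣≡∣p∪q∣+∣p∩q∣ (outside ∷ p) (inside ∷ q)  = trans (ℕP.+-suc ∣ p ∣ ∣ q ∣) (cong suc (∣p∣+∣q∣≡∣p∪q∣+∣p∩q∣ p q))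
∣p∣+∣q∣≡∣p∪q∣+∣p∩q∣ (outside ∷ p) (outside ∷ q) = ∣p∣+∣q∣≡∣p∪q∣+∣p∩q∣ p q

∣p++q∣≡∣p∣+∣q∣ : ∀ {m n} (p : Subset m) (q : Subset n) → ∣ p ++ q ∣ ≡ ∣ p ∣ ℕ.+ ∣ q ∣
∣p++q∣≡∣p∣+∣q∣ []            q = refl
∣p++q∣≡∣p∣+∣q∣ (inside ∷ p)  q = cong suc (∣p++q∣≡∣p∣+∣q∣ p q)
∣p++q∣≡∣p∣+∣q∣ (outside ∷ p) q = ∣p++q∣≡∣p∣+∣q∣ p q

∈-++⁺ˡ : ∀ {m n} {p : Subset m} {q : Subset n} {i} → i ∈ p → (i ↑ˡ n) ∈ (p ++ q)
∈-++⁺ˡ here      = here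
∈-++⁺ˡ (there i∈p) = there (∈-++⁺ˡ i∈p)

∈-++⁺ʳ : ∀ {m n} (p : Subset m) {q : Subset n} {i} → i ∈ q → (m ↑ʳ i) ∈ (p ++ q)
∈-++⁺ʳ []      i∈q = i∈q
∈-++⁺ʳ (_ ∷ p) i∈q = there (∈-++⁺ʳ p i∈q)

Item : ℕ → Set
Item m = Fin (m ℕ.+ m)

extent : (m : ℕ) → Orient → Item m → ℕ
extent m vert  = width m
extent m horiz = height m

Inseparable : (m : ℕ) → Orient → Item m → Item m → Set
Inseparable m o a i = Nsize m ℕ.< extent m o a ℕ.+ extent m o i

inseparable-sym : ∀ {m o a i} → Inseparable m o a i → Inseparable m o i a
inseparable-sym {m} {o} {a} {i} = subst (Nsize m ℕ.<_) (ℕP.+-comm (extent m o a) (extent m o i))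

Pair : ℕ → Set
Pair m = Item m × Item m

anchor : ∀ {m} → Orient → Pair m → Item m
anchor vert  (v , h) = h
anchor horiz (v , h) = v

Pins : (m : ℕ) → Pair m → Pair m → Set
Pins m p (v , h) = ∀ o → Inseparable m o (anchor {m} o p) v × Inseparable m o (anchor {m} o p) h

knapsack : ℕ → Box
knapsack m = box (ℕ→ℚ 0) (ℕ→ℚ (Nsize m)) (ℕ→ℚ 0) (ℕ→ℚ (Nsize m))

module Separation {m : ℕ} (pos : Placement m) (S : Subset (m ℕ.+ m)) (packing : IsPacking m pos S) where

  start : Orient → Item m → ℚ
  start vert  = x₀ m pos
  start horiz = y₀ m pos

  end : Orient → Item m → ℚ
  end o i = start o i + ℕ→ℚ (extent m o i)

  _∈ᵇ_ : Item m → Box → Set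
  i ∈ᵇ B = In m pos S i B

  in-knapsack : ∀ {i} → i ∈ S → i ∈ᵇ knapsack m
  in-knapsack {i} i∈S = i∈S , IsPacking.inside packing i i∈S

  knapsack-bounds : ∀ o {i} → i ∈ S → ℕ→ℚ 0 ≤ start o i × end o i ≤ ℕ→ℚ (Nsize m)
  knapsack-bounds vert  i∈S with IsPacking.inside packing _ i∈S
  ... | 0≤x₀ , x₁≤N , _ , _ = 0≤x₀ , x₁≤N
  knapsack-bounds horiz i∈S with IsPacking.inside packing _ i∈S
  ... | _ , _ , 0≤y₀ , y₁≤N = 0≤y₀ , y₁≤N

  side-by-side⇒fit : ∀ o {i j} → i ∈ S → j ∈ S → end o i ≤ start o j →
                     extent m o i ℕ.+ extent m o j ℕ.≤ Nsize m
  side-by-side⇒fit o {i} {j} i∈S j∈S i≤j = ℕ→ℚ-cancel-≤ (begin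
    ℕ→ℚ (extent m o i ℕ.+ extent m o j)          ≡⟨ ℕ→ℚ-+ (extent m o i) (extent m o j) ⟩
    ℕ→ℚ (extent m o i) + ℕ→ℚ (extent m o j)      ≡⟨ cong (_+ ℕ→ℚ (extent m o j)) (ℚP.+-identityˡ (ℕ→ℚ (extent m o i))) ⟨
    (ℕ→ℚ 0 + ℕ→ℚ (extent m o i)) + ℕ→ℚ (extent m o j) ≤⟨ ℚP.+-monoˡ-≤ _ (ℚP.+-monoˡ-≤ _ (proj₁ (knapsack-bounds o i∈S))) ⟩
    end o i + ℕ→ℚ (extent m o j)                  ≤⟨ ℚP.+-monoˡ-≤ _ i≤j ⟩
    end o j                                       ≤⟨ proj₂ (knapsack-bounds o j∈S) ⟩
    ℕ→ℚ (Nsize m)                                 ∎)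
    where open ℚP.≤-Reasoning

  inseparable-overlap : ∀ o {a i} → Inseparable m o a i → a ∈ S → i ∈ S → ¬ (end o a ≤ start o i)
  inseparable-overlap o insep a∈S i∈S a≤i = ℕP.<⇒≱ insep (side-by-side⇒fit o a∈S i∈S a≤i)

  cut-sorts : ∀ o {c B i} → NoCross m pos S o c B → i ∈ᵇ B → i ∈ᵇ lower o c B ⊎ i ∈ᵇ upper o c B
  cut-sorts vert  no-cross i∈B@(i∈S , l , r , b , t) with no-cross _ i∈B
  ... | inj₁ r≤c = inj₁ (i∈S , l , r≤c , b , t)
  ... | inj₂ c≤l = inj₂ (i∈S , c≤l , r , b , t)
  cut-sorts horiz no-cross i∈B@(i∈S , l , r , b , t) with no-cross _ i∈B
  ... | inj₁ t≤c = inj₁ (i∈S , l , r , b , t≤c)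
  ... | inj₂ c≤b = inj₂ (i∈S , l , r , c≤b , t)

  end≤cut : ∀ o {c B i} → i ∈ᵇ lower o c B → end o i ≤ c
  end≤cut vert  (_ , _ , r≤c , _ , _) = r≤c
  end≤cut horiz (_ , _ , _ , _ , t≤c) = t≤c

  cut≤start : ∀ o {c B i} → i ∈ᵇ upper o c B → c ≤ start o i
  cut≤start vert  (_ , c≤l , _ , _ , _) = c≤l
  cut≤start horiz (_ , _ , _ , c≤b , _) = c≤b

  stays-lower : ∀ o {c B a i} → NoCross m pos S o c B → Inseparable m o a i →
                a ∈ᵇ lower o c B → i ∈ᵇ B → i ∈ᵇ lower o c B
  stays-lower o no-cross insep a∈L i∈B with cut-sorts o no-cross i∈B
  ... | inj₁ i∈L = i∈L
  ... | inj₂ i∈U = ⊥-elim (inseparable-overlap o insep (proj₁ a∈L) (proj₁ i∈U)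
                     (ℚP.≤-trans (end≤cut o a∈L) (cut≤start o i∈U)))

  stays-upper : ∀ o {c B a i} → NoCross m pos S o c B → Inseparable m o a i →
                a ∈ᵇ upper o c B → i ∈ᵇ B → i ∈ᵇ upper o c B
  stays-upper o no-cross insep a∈U i∈B with cut-sorts o no-cross i∈B
  ... | inj₁ i∈L = ⊥-elim (inseparable-overlap o (inseparable-sym {m} {o} insep) (proj₁ i∈L) (proj₁ a∈U)
                     (ℚP.≤-trans (end≤cut o i∈L) (cut≤start o a∈U)))
  ... | inj₂ i∈U = i∈U

  stage-keeps : ∀ {k o B a} → Cuts m pos S k o B → a ∈ᵇ B →
                Σ Box λ B′ → Sep m pos S k (flip o) B′ ×
                  (∀ {i} → Inseparable m o a i → i ∈ᵇ B → i ∈ᵇ B′)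
  stage-keeps (last sep) a∈B = _ , sep , λ _ i∈B → i∈B
  stage-keeps {o = o} (cut c _ _ no-cross cuts sep) a∈B with cut-sorts o no-cross a∈B
  ... | inj₁ a∈L = let B′ , sep′ , keeps = stage-keeps cuts a∈L in
                   B′ , sep′ , λ insep i∈B → keeps insep (stays-lower o no-cross insep a∈L i∈B)
  ... | inj₂ a∈U = _ , sep , λ insep → stays-upper o no-cross insep a∈U

  PairIn : Box → Pair m → Set
  PairIn B (v , h) = v ∈ᵇ B × h ∈ᵇ B

  anchor-in : ∀ o {B} p → PairIn B p → anchor {m} o p ∈ᵇ B
  anchor-in vert  _ (_ , h∈B) = h∈B
  anchor-in horiz _ (v∈B , _) = v∈B

  chain≤stages : ∀ {k o B} → Sep m pos S k o B → (ps : List (Pair m)) → AllPairs (Pins m) ps →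
                 All (λ (v , h) → v ≢ h) ps → All (PairIn B) ps → length ps ℕ.≤ k
  chain≤stages _ [] _ _ _ = z≤n
  chain≤stages (done at-most-one) (_ ∷ _) _ (v≢h ∷ _) ((v∈B , h∈B) ∷ _) =
    ⊥-elim (v≢h (at-most-one _ _ v∈B h∈B))
  chain≤stages {o = o} (stage cuts) (p ∷ ps) (pins ∷ chain) (_ ∷ distinct) (p∈B ∷ ps∈B)
    with stage-keeps cuts (anchor-in o p p∈B)
  ... | _ , sep′ , keeps = s≤s (chain≤stages sep′ ps chain distinct (All.zipWith moves (pins , ps∈B)))
    where
    moves : ∀ {q} → Pins m p q × PairIn _ q → PairIn _ q
    moves (pin , v∈B , h∈B) = keeps (proj₁ (pin o)) v∈B , keeps (proj₂ (pin o)) h∈B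

module _ {m : ℕ} where

  V H : Fin m → Item m
  V j = j ↑ˡ m
  H j = m ↑ʳ j

  V≢H : ∀ j → V j ≢ H j
  V≢H j V≡H with trans (sym (FinP.splitAt-↑ˡ m j m)) (trans (cong (splitAt m) V≡H) (FinP.splitAt-↑ʳ m m j))
  ... | ()

  width-V : ∀ j → width m (V j) ≡ 2 ^ toℕ j
  width-V j rewrite FinP.splitAt-↑ˡ m j m = refl

  height-V : ∀ j → height m (V j) ≡ Nsize m ∸ (2 ^ suc (toℕ j) ∸ 1)
  height-V j rewrite FinP.splitAt-↑ˡ m j m = refl

  width-H : ∀ j → width m (H j) ≡ Nsize m ∸ (2 ^ toℕ j ∸ 1)
  width-H j rewrite FinP.splitAt-↑ʳ m m j = refl

  height-H : ∀ j → height m (H j) ≡ 2 ^ toℕ j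
  height-H j rewrite FinP.splitAt-↑ʳ m m j = refl

  VH : Fin m → Pair m
  VH j = V j , H j

  bar-inseparable : ∀ {a y} → a ℕ.≤ suc m → 2 ^ a ∸ 1 ℕ.< y → Nsize m ℕ.< Nsize m ∸ (2 ^ a ∸ 1) ℕ.+ y
  bar-inseparable a≤1+m = n<n∸x+y (ℕP.<⇒≤ (2^a∸1<2^b a≤1+m))

  VH-pins : ∀ {i j} → i <ᶠ j → Pins m (VH i) (VH j)
  VH-pins {i} {j} i<j vert rewrite width-H i | width-V j | width-H j =
    bar-inseparable (ℕP.m≤n⇒m≤1+n i≤m) (2^a∸1<2^b (ℕP.<⇒≤ i<j)) ,
    bar-inseparable (ℕP.m≤n⇒m≤1+n i≤m) (2^a∸1<2^[1+m]∸[2^b∸1] (ℕP.<⇒≤ i<j) (ℕP.<⇒≤ (FinP.toℕ<n j)))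
    where i≤m = ℕP.<⇒≤ (FinP.toℕ<n i)
  VH-pins {i} {j} i<j horiz rewrite height-V i | height-V j | height-H j =
    bar-inseparable (s≤s i≤m) (2^a∸1<2^[1+m]∸[2^b∸1] (s≤s (ℕP.<⇒≤ i<j)) (FinP.toℕ<n j)) ,
    bar-inseparable (s≤s i≤m) (2^a∸1<2^b i<j)
    where i≤m = ℕP.<⇒≤ (FinP.toℕ<n i)

∣S∣≤m+stages : ∀ {m pos k o} (S : Subset (m ℕ.+ m)) → IsPacking m pos S →
               Sep m pos S k o (knapsack m) → ∣ S ∣ ℕ.≤ m ℕ.+ k
∣S∣≤m+stages {m} {pos} {k} S packing sep with Vec.splitAt m S
... | p , q , refl = begin
  ∣ p ++ q ∣                 ≡⟨ ∣p++q∣≡∣p∣+∣q∣ p q ⟩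
  ∣ p ∣ ℕ.+ ∣ q ∣            ≡⟨ ∣p∣+∣q∣≡∣p∪q∣+∣p∩q∣ p q ⟩
  ∣ p ∪ q ∣ ℕ.+ ∣ p ∩ q ∣    ≤⟨ ℕP.+-mono-≤ (∣p∣≤n (p ∪ q)) paired≤k ⟩
  m ℕ.+ k                    ∎
  where
  open ℕP.≤-Reasoning
  open Separation pos (p ++ q) packing
  paired-in : ∀ {j} → j ∈ p ∩ q → PairIn (knapsack m) (VH j)
  paired-in j∈p∩q with x∈p∩q⁻ p q j∈p∩q
  ... | j∈p , j∈q = in-knapsack (∈-++⁺ˡ j∈p) , in-knapsack (∈-++⁺ʳ p j∈q)
  paired≤k : ∣ p ∩ q ∣ ℕ.≤ k
  paired≤k = subst (ℕ._≤ k) (trans (ListP.length-map VH (elements (p ∩ q))) (length-elements (p ∩ q)))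
    (chain≤stages sep (map VH (elements (p ∩ q)))
      (AllPairsP.map⁺ (AllPairs.map VH-pins (elements-sorted (p ∩ q))))
      (AllP.map⁺ (All.universal V≢H _))
      (AllP.map⁺ (All.map paired-in (elements-∈ (p ∩ q)))))

¼ε[1+m]≤k : ∀ {ε m s k} → 0ℚ ≤ ε → 1 ℕ.≤ m → s ℕ.≤ m ℕ.+ k →
        ℕ→ℚ (m ℕ.+ m) ≤ (ℕ→ℚ 2 - ε) * ℕ→ℚ s → ½ * ½ * ε * ℕ→ℚ (suc m) ≤ ℕ→ℚ k
¼ε[1+m]≤k {ε} {m} {s} {k} 0≤ε 1≤m s≤m+k 2m≤[2-ε]s =
  subst (λ x → ½ * ½ * ε * x ≤ ℕ→ℚ k) (sym (ℕ→ℚ-+ 1 m))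
    (¼E[1+M]≤K ε (ℕ→ℚ s) (ℕ→ℚ m) (ℕ→ℚ k) 0≤ε (ℕ→ℚ-mono-≤ (z≤n {s})) (ℕ→ℚ-mono-≤ 1≤m)
      (subst (ℕ→ℚ s ≤_) (ℕ→ℚ-+ m k) (ℕ→ℚ-mono-≤ s≤m+k))
      (subst (_≤ (ℕ→ℚ 2 - ε) * ℕ→ℚ s) (ℕ→ℚ-+ m m) 2m≤[2-ε]s))

mainTheorem15 : Σ ℚ λ c → 0ℚ < c ×
    ((ε : ℚ) → 0ℚ < ε → ε < ½ →
      Σ ℕ λ m₀ → (m : ℕ) → m₀ ℕ.≤ m →
        (S : Subset (m ℕ.+ m)) (k : ℕ) →
        ℕ→ℚ (m ℕ.+ m) ≤ (ℕ→ℚ 2 - ε) * ℕ→ℚ ∣ S ∣ →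
        KStagePacking m S k →
        c * ε * ℕ→ℚ (ℕ.suc m) ≤ ℕ→ℚ k)
mainTheorem15 = ½ * ½ , *<* (ℤ.+<+ (s≤s z≤n)) , λ ε 0<ε _ → 1 ,
  λ m 1≤m S k 2m≤[2-ε]∣S∣ (pos , packing , _ , sep) →
    ¼ε[1+m]≤k (ℚP.<⇒≤ 0<ε) 1≤m (∣S∣≤m+stages S packing sep) 2m≤[2-ε]∣S∣
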